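{- Let $G$ be an interval graph and let $C$ be the size of a largest clique in $G$. Then $\mathrm{boolw}(G)\le \log_2 C$.
   Context: A graph is an interval graph if it has an intersection model consisting of intervals on a straight line (one per vertex, adjacent iff the intervals intersect). For $A\subseteq V(G)$ write $\overline{A}=V(G)\setminus A$. A decomposition tree of $G$ is a pair $(T,\delta)$ where $T$ is a tree whose internal nodes have degree three and which has $|V(G)|$ leaves, and $\delta$ is a bijection between $V(G)$ and the leaves of $T$; each edge of $T$ defines a cut $\{A,\overline{A}\}$ given by the leaves of the two components of $T$ minus that edge. Define $\mathrm{cut\text{ - }bool}(A)=\log_2|\{S\subseteq\overline{A} : \exists X\subseteq A,\ S=\overline{A}\cap\bigcup_{x\in X}N(x)\}|$. The boolean-width of $(T,\delta)$ is the maximum of $\mathrm{cut\text{ - }bool}(A)$ over cuts given by edges of $T$, and $\mathrm{boolw}(G)$ is the minimum over all decomposition trees of $G$. -}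

module Defs where

open import Data.Bool using (Bool; true; false; _∧_; _∨_; not; T)
open import Data.Nat using (ℕ; suc; _≤_)
open import Data.Fin using (Fin)
open import Data.Fin.Subset using (Subset; _∩_; _∪_; ∁; ⊥; ⁅_⁆; ∣_∣)
open import Data.Vec using (Vec; []; _∷_; lookup; tabulate)
open import Data.List using (List; []; _∷_; _++_; length; filterᵇ; allFin; map)
open import Data.Bool.ListAction using (any)
open import Data.List.Membership.Propositional using (_∈_)
open import Data.List.Relation.Unary.Unique.Propositional using (Unique)
open import Data.Product using (_×_; ∃-syntax; Σ-syntax)
open import Relation.Binary.PropositionalEquality using (_≡_; _≢_)
open import Relation.Nullary using (does)
open import Function.Bundles using (_⇔_)
open import Data.Vec.Properties using () renaming (≡-dec to vec-≡-dec)
open import Data.Bool.Properties using () renaming (_≟_ to _≟ᵇ_)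

record Graph (n : ℕ) : Set where
  field
    adj     : Fin n → Fin n → Bool
    adj-sym : ∀ i j → adj i j ≡ adj j i
    adj-irr : ∀ i → adj i i ≡ false
open Graph public

-- Interval graph: closed intervals [l i , r i] on the line (integer
-- endpoints; every finite interval model can be taken so), adjacent iff
-- the intervals intersect.
IsIntervalGraph : ∀ {n} → Graph n → Set
IsIntervalGraph {n} G =
  Σ[ l ∈ (Fin n → ℕ) ] Σ[ r ∈ (Fin n → ℕ) ]
    ((∀ (i : Fin n) → l i ≤ r i) ×
     (∀ (i j : Fin n) → i ≢ j →
        (T (adj G i j) ⇔ (l i ≤ r j × l j ≤ r i))))

IsClique : ∀ {n} → Graph n → Subset n → Set
IsClique G K = ∀ i j → i ≢ j → lookup K i ≡ true → lookup K j ≡ true →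
               adj G i j ≡ true

IsMaxCliqueSize : ∀ {n} → Graph n → ℕ → Set
IsMaxCliqueSize G C =
  (∃[ K ] (IsClique G K × ∣ K ∣ ≡ C)) ×
  (∀ K → IsClique G K → ∣ K ∣ ≤ C)

allSubsets : ∀ n → List (Subset n)
allSubsets 0 = [] ∷ []
allSubsets (suc n) = map (true ∷_) (allSubsets n) ++ map (false ∷_) (allSubsets n)

nbhdUnion : ∀ {n} → Graph n → Subset n → Subset n
nbhdUnion {n} G X = tabulate λ y → any (λ x → lookup X x ∧ adj G x y) (allFin n)

_⊆ᵇ_ : ∀ {n} → Subset n → Subset n → Bool
[] ⊆ᵇ [] = true
(a ∷ xs) ⊆ᵇ (b ∷ ys) = (not a ∨ b) ∧ (xs ⊆ᵇ ys)

_≡ᵇ_ : ∀ {n} → Subset n → Subset n → Bool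
S ≡ᵇ S' = does (vec-≡-dec _≟ᵇ_ S S')

-- |{ S ⊆ Ā : ∃ X ⊆ A, S = Ā ∩ N(X) }|   (so cut-bool(A) = log₂ of this)
cutCount : ∀ {n} → Graph n → Subset n → ℕ
cutCount {n} G A =
  length (filterᵇ (λ S → any (λ X → (X ⊆ᵇ A) ∧ (S ≡ᵇ (∁ A ∩ nbhdUnion G X))) (allSubsets n))
                 (allSubsets n))

-- An unrooted tree with internal nodes of degree 3 whose leaves are the
-- vertices is represented by rooting it at (the subdivision of) an edge:
-- a full binary tree with leaves labelled by vertices.  The edges of the
-- unrooted tree then correspond exactly to the proper subtrees, the cut
-- of an edge being {leaves of the subtree, the rest}.

data BTree (n : ℕ) : Set where
  leaf : Fin n → BTree n
  node : BTree n → BTree n → BTree n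

leaves : ∀ {n} → BTree n → List (Fin n)
leaves (leaf v) = v ∷ []
leaves (node l r) = leaves l ++ leaves r

leafSet : ∀ {n} → BTree n → Subset n
leafSet (leaf v) = ⁅ v ⁆
leafSet (node l r) = leafSet l ∪ leafSet r

properSubtrees : ∀ {n} → BTree n → List (BTree n)
properSubtrees (leaf v) = []
properSubtrees (node l r) = l ∷ r ∷ (properSubtrees l ++ properSubtrees r)

IsDecompositionTree : ∀ {n} → BTree n → Set
IsDecompositionTree t = Unique (leaves t) × (∀ v → v ∈ leaves t)

-- the tree has boolean-width ≤ log₂ k, i.e. every cut has count ≤ k
CutCountsAtMost : ∀ {n} → Graph n → BTree n → ℕ → Set
CutCountsAtMost G t k = ∀ s → s ∈ properSubtrees t → cutCount G (leafSet s) ≤ k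

BoolwAtMostLog : ∀ {n} → Graph n → ℕ → Set
BoolwAtMostLog G k = ∃[ t ] (IsDecompositionTree t × CutCountsAtMost G t k)

-- Fix an interval model [l v, r v] of G and list the vertices by decreasing
-- right endpoint.  The caterpillar built from this list is a decomposition
-- tree whose cuts are of two kinds:
--   * a single vertex {v}: its realised sets are N(∅) ∩ Ā and N(v) ∩ Ā, and
--     if v has a neighbour at all then {v, y} is a clique, so C ≥ 2;
--   * a set A closed downwards in r (x ∈ A, y ∉ A ⇒ r x ≤ r y): if x is the
--     member of X ⊆ A with the largest right endpoint, then N(X) ∩ Ā is the
--     set of y ∉ A with l y ≤ r x.  These sets form a chain, and each one
--     together with x is a clique, so each has fewer than C elements; a
--     chain of distinct sets with sizes below C has at most C members.
module Submission where

open import Defs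
open import Data.Bool using (Bool; true; false; _∧_; T)
open import Data.Bool.Properties using (T-≡; T-∧; T?) renaming (_≟_ to _≟ᵇ_)
open import Data.Empty using (⊥-elim)
open import Data.Nat using (ℕ; zero; suc; _≤_; _<_; z≤n; s≤s; _≤ᵇ_)
open import Data.Nat.Properties
  using (≤-trans; ≤-total; ≤⇒≤ᵇ; ≤ᵇ⇒≤; <-irrefl; <-≤-trans; ≤-decTotalOrder; ≤-totalOrder)
  renaming (_≟_ to _≟ℕ_)
open import Data.Fin using (Fin; zero)
open import Data.Fin.Properties using (any?)
open import Data.Fin.Subset
  using (Subset; _⊆_; _⊂_; ⁅_⁆; _∪_; _∩_; ∁; ⊥; ∣_∣; Nonempty)
  renaming (_∈_ to _∈ₛ_; _∉_ to _∉ₛ_)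
open import Data.Fin.Subset.Properties
  using ( _∈?_; ⊆-antisym; ⊥⊆; ∉⊥; ∣⊥∣≡0; x∈⁅x⁆; x∈⁅y⁆⇒x≡y; x≢y⇒x∉⁅y⁆; ∣⁅x⁆∣≡1
        ; x∈p∪q⁺; x∈p∪q⁻; p⊆p∪q; q⊆p∪q; x∈p∩q⁺; x∈p∩q⁻; x∈∁p⇒x∉p; x∉p⇒x∈∁p
        ; p⊂q⇒∣p∣<∣q∣; Empty-unique; nonempty?)
open import Data.Vec using (_∷_; lookup; tabulate)
import Data.Vec as Vec
open import Data.Vec.Properties
  using (lookup∘tabulate; []=⇒lookup; lookup⇒[]=; ∷-injectiveʳ)
  renaming (≡-dec to vec-≡-dec)
open import Data.List using (List; []; _∷_; length; filter; filterᵇ; map; allFin)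
open import Data.List.Properties using (filter-notAll; length-upTo)
open import Data.Bool.ListAction using (any)
open import Data.List.Membership.Propositional using (_∈_; _∉_)
open import Data.List.Membership.Propositional.Properties
  using (∈-filter⁺; ∈-filter⁻; ∈-allFin; ∈-map⁻; ∈-++⁻; ∈-++⁺ˡ; ∈-++⁺ʳ; ∈-upTo⁺)
open import Data.List.Relation.Unary.Any as Any using (here; there; satisfied)
open import Data.List.Relation.Unary.Any.Properties using (any⁺; any⁻)
open import Data.List.Relation.Unary.All as All using (All)
open import Data.List.Relation.Unary.AllPairs using (AllPairs; []; _∷_)
open import Data.List.Relation.Unary.Unique.Propositional using (Unique)
import Data.List.Relation.Unary.Unique.Propositional.Properties as Unique
import Data.List.Relation.Binary.Permutation.Setoid.Properties as PermutationSetoid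
open import Data.List.Relation.Binary.Permutation.Propositional using (↭-sym; ↭⇒↭ₛ)
open import Data.List.Relation.Binary.Permutation.Propositional.Properties using (∈-resp-↭)
open import Data.List.Relation.Unary.Sorted.TotalOrder.Properties using (Sorted⇒AllPairs)
import Data.List.Sort as Sort
open import Data.List.Extrema ≤-totalOrder using (argmax; argmax-sel; f[xs]≤f[argmax])
open import Data.Product using (_×_; _,_; proj₁; proj₂; ∃-syntax)
open import Data.Sum using (_⊎_; inj₁; inj₂; [_,_]′)
import Data.Sum as Sum
open import Function using (_∘_; id)
open import Function.Bundles using (_⇔_; mk⇔; Equivalence)
open import Level using (0ℓ)
open import Relation.Binary.Bundles using (DecTotalOrder)
open import Relation.Binary.Definitions using (DecidableEquality)
import Relation.Binary.Construct.On as On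
import Relation.Binary.Construct.Flip.EqAndOrd as Flip
open import Relation.Binary.PropositionalEquality
  using (_≡_; _≢_; refl; sym; trans; subst; setoid)
open import Relation.Nullary using (yes; no; ¬_; ¬?)

injection-length : ∀ {a b} {A : Set a} {B : Set b} (_≟_ : DecidableEquality B)
                   (f : A → B) {xs : List A} {ys : List B} → Unique xs →
                   (∀ {x y} → x ∈ xs → y ∈ xs → f x ≡ f y → x ≡ y) →
                   (∀ {x} → x ∈ xs → f x ∈ ys) → length xs ≤ length ys
injection-length _≟_ f {[]} _ _ _ = z≤n
injection-length _≟_ f {x ∷ xs} {ys} (x∉xs ∷ unique) injective into =
  ≤-trans (s≤s (injection-length _≟_ f unique (λ p q → injective (there p) (there q)) into-rest))
          (filter-notAll (λ b → ¬? (b ≟ f x)) ys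
                         (Any.map (λ fx≡b b≢fx → b≢fx (sym fx≡b)) (into (here refl))))
  where
  -- the images of the remaining elements avoid f x, so they survive its removal
  into-rest : ∀ {z} → z ∈ xs → f z ∈ filter (λ b → ¬? (b ≟ f x)) ys
  into-rest z∈xs = ∈-filter⁺ (λ b → ¬? (b ≟ f x)) (into (there z∈xs))
    (λ fz≡fx → All.lookup x∉xs z∈xs (injective (here refl) (there z∈xs) (sym fz≡fx)))

∈⇔T-lookup : ∀ {m} {p : Subset m} {x : Fin m} → x ∈ₛ p ⇔ T (lookup p x)
∈⇔T-lookup {p = p} {x} =
  mk⇔ (Equivalence.from T-≡ ∘ []=⇒lookup) (lookup⇒[]= x p ∘ Equivalence.to T-≡)

∈-tabulate : ∀ {m} {f : Fin m → Bool} {x : Fin m} → x ∈ₛ tabulate f ⇔ T (f x)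
∈-tabulate {f = f} {x} =
  mk⇔ (subst T (lookup∘tabulate f x) ∘ Equivalence.to ∈⇔T-lookup)
      (Equivalence.from ∈⇔T-lookup ∘ subst T (sym (lookup∘tabulate f x)))

⊆-size-≡ : ∀ {m} {p q : Subset m} → p ⊆ q → ∣ p ∣ ≡ ∣ q ∣ → p ≡ q
⊆-size-≡ {p = p} {q} p⊆q same-size = ⊆-antisym p⊆q q⊆p
  where
  q⊆p : q ⊆ p
  q⊆p {x} x∈q with x ∈? p
  ... | yes x∈p = x∈p
  ... | no x∉p = ⊥-elim (<-irrefl same-size (p⊂q⇒∣p∣<∣q∣ (p⊆q , x , x∈q , x∉p)))

⊆-singleton : ∀ {m} {X : Subset m} {v : Fin m} → X ⊆ ⁅ v ⁆ → X ≡ ⊥ ⊎ X ≡ ⁅ v ⁆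
⊆-singleton {X = X} {v} X⊆v with v ∈? X
... | yes v∈X = inj₂ (⊆-antisym X⊆v (λ x∈v → subst (_∈ₛ X) (sym (x∈⁅y⁆⇒x≡y v x∈v)) v∈X))
... | no v∉X = inj₁ (Empty-unique λ (x , x∈X) →
                       v∉X (subst (_∈ₛ X) (x∈⁅y⁆⇒x≡y v (X⊆v x∈X)) x∈X))

maximiser : ∀ {m} (f : Fin m → ℕ) {X : Subset m} → Nonempty X →
            ∃[ x ] (x ∈ₛ X × (∀ {z} → z ∈ₛ X → f z ≤ f x))
maximiser {m} f {X} (x₀ , x₀∈X) = best , best∈X , maximal
  where
  members : List (Fin m)
  members = filter (_∈? X) (allFin m)
  best : Fin m
  best = argmax f x₀ members
  best∈X : best ∈ₛ X
  best∈X with argmax-sel f x₀ members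
  ... | inj₁ best≡x₀ = subst (_∈ₛ X) (sym best≡x₀) x₀∈X
  ... | inj₂ best∈ = proj₂ (∈-filter⁻ (_∈? X) {xs = allFin m} best∈)
  maximal : ∀ {z} → z ∈ₛ X → f z ≤ f best
  maximal z∈X = All.lookup (f[xs]≤f[argmax] x₀ members) (∈-filter⁺ (_∈? X) (∈-allFin _) z∈X)

allSubsets-unique : ∀ m → Unique (allSubsets m)
allSubsets-unique zero = All.[] ∷ []
allSubsets-unique (suc m) =
  Unique.++⁺ (Unique.map⁺ ∷-injectiveʳ (allSubsets-unique m))
             (Unique.map⁺ ∷-injectiveʳ (allSubsets-unique m)) disjoint
  where
  disjoint : ∀ {S} → ¬ (S ∈ map (true ∷_) (allSubsets m) × S ∈ map (false ∷_) (allSubsets m))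
  disjoint (S∈ₜ , S∈f) with ∈-map⁻ (true ∷_) S∈ₜ | ∈-map⁻ (false ∷_) S∈f
  ... | _ , _ , refl | _ , _ , ()

⊆ᵇ-sound : ∀ {m} (X A : Subset m) → T (X ⊆ᵇ A) → X ⊆ A
⊆ᵇ-sound (true ∷ X) (true ∷ A) _ Vec.here = Vec.here
⊆ᵇ-sound (true ∷ X) (false ∷ A) () Vec.here
⊆ᵇ-sound (_ ∷ X) (_ ∷ A) t (Vec.there x∈X) = Vec.there (⊆ᵇ-sound X A (proj₂ (Equivalence.to T-∧ t)) x∈X)

≡ᵇ-sound : ∀ {m} (S S' : Subset m) → T (S ≡ᵇ S') → S ≡ S'
≡ᵇ-sound S S' t with vec-≡-dec _≟ᵇ_ S S'
... | yes S≡S' = S≡S'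

module CutsOf {n : ℕ} (G : Graph n) where

  trace : Subset n → Subset n → Subset n
  trace A X = ∁ A ∩ nbhdUnion G X

  Realized : Subset n → Subset n → Set
  Realized A S = ∃[ X ] (X ⊆ A × S ≡ trace A X)

  ∈-trace⁻ : ∀ {A X y} → y ∈ₛ trace A X → y ∉ₛ A × ∃[ x ] (x ∈ₛ X × T (adj G x y))
  ∈-trace⁻ {A} {X} {y} y∈ =
    let y∈∁A , y∈NX = x∈p∩q⁻ (∁ A) (nbhdUnion G X) y∈
        x , t = satisfied (any⁻ _ (allFin n) (Equivalence.to ∈-tabulate y∈NX))
        x∈X , xy = Equivalence.to T-∧ t
    in x∈∁p⇒x∉p y∈∁A , x , Equivalence.from ∈⇔T-lookup x∈X , xy

  ∈-trace⁺ : ∀ {A X x y} → y ∉ₛ A → x ∈ₛ X → T (adj G x y) → y ∈ₛ trace A X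
  ∈-trace⁺ {X = X} {x} {y} y∉A x∈X xy =
    x∈p∩q⁺ (x∉p⇒x∈∁p y∉A , Equivalence.from ∈-tabulate
      (any⁺ (λ z → lookup X z ∧ adj G z y)
            (Any.map (λ { refl → Equivalence.from T-∧ (Equivalence.to ∈⇔T-lookup x∈X , xy) })
                     (∈-allFin x))))

  trace-silent : ∀ {A X} → (∀ {x y} → x ∈ₛ X → y ∉ₛ A → ¬ T (adj G x y)) → trace A X ≡ ⊥
  trace-silent silent = Empty-unique λ (y , y∈) →
    let y∉A , x , x∈X , xy = ∈-trace⁻ y∈ in silent x∈X y∉A xy

  realizedSets : Subset n → List (Subset n)
  realizedSets A = filterᵇ realizes (allSubsets n)
    where
    realizes : Subset n → Bool
    realizes S = any (λ X → (X ⊆ᵇ A) ∧ (S ≡ᵇ trace A X)) (allSubsets n)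

  realizedSets-unique : ∀ A → Unique (realizedSets A)
  realizedSets-unique A = Unique.filter⁺ _ (allSubsets-unique n)

  realizedSets-sound : ∀ A {S} → S ∈ realizedSets A → Realized A S
  realizedSets-sound A {S} S∈ =
    let X , t = satisfied (any⁻ _ (allSubsets n) (proj₂ (∈-filter⁻ _ {xs = allSubsets n} S∈)))
        X⊆ᵇA , S≡ᵇ = Equivalence.to T-∧ t
    in X , ⊆ᵇ-sound X A X⊆ᵇA , ≡ᵇ-sound S (trace A X) S≡ᵇ

  cutCount-injection : ∀ A {B : Set} (_≟_ : DecidableEquality B) (f : Subset n → B) {ys : List B} →
                       (∀ {S S'} → Realized A S → Realized A S' → f S ≡ f S' → S ≡ S') →
                       (∀ {S} → Realized A S → f S ∈ ys) → cutCount G A ≤ length ys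
  cutCount-injection A _≟_ f injective into =
    injection-length _≟_ f (realizedSets-unique A)
      (λ p q → injective (realizedSets-sound A p) (realizedSets-sound A q))
      (into ∘ realizedSets-sound A)

  listedCut-bound : ∀ A (ys : List (Subset n)) → (∀ {S} → Realized A S → S ∈ ys) →
                    cutCount G A ≤ length ys
  listedCut-bound A ys = cutCount-injection A (vec-≡-dec _≟ᵇ_) id (λ _ _ S≡S' → S≡S')

  -- If the realised sets form a chain of sets of size below k, there are at
  -- most k of them: comparable sets of equal size coincide, so size is injective.
  chainCut-bound : ∀ A k → (∀ {S S'} → Realized A S → Realized A S' → S ⊆ S' ⊎ S' ⊆ S) →
                   (∀ {S} → Realized A S → ∣ S ∣ < k) → cutCount G A ≤ k
  chainCut-bound A k chain small =
    subst (cutCount G A ≤_) (length-upTo k)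
          (cutCount-injection A _≟ℕ_ ∣_∣ size-injective (∈-upTo⁺ ∘ small))
    where
    size-injective : ∀ {S S'} → Realized A S → Realized A S' → ∣ S ∣ ≡ ∣ S' ∣ → S ≡ S'
    size-injective RS RS' same with chain RS RS'
    ... | inj₁ S⊆S' = ⊆-size-≡ S⊆S' same
    ... | inj₂ S'⊆S = sym (⊆-size-≡ S'⊆S (sym same))

-- every clique of G has at most C vertices (only this half of
-- IsMaxCliqueSize is needed)
CliquesAtMost : ∀ {n} → Graph n → ℕ → Set
CliquesAtMost G C = ∀ K → IsClique G K → ∣ K ∣ ≤ C

module Cliques {n : ℕ} (G : Graph n) {C : ℕ} (cliques : CliquesAtMost G C) where

  clique-intro : ∀ {K} → (∀ {i j} → i ≢ j → i ∈ₛ K → j ∈ₛ K → T (adj G i j)) → IsClique G K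
  clique-intro adjacent i j i≢j Ki Kj =
    Equivalence.to T-≡ (adjacent i≢j (lookup⇒[]= i _ Ki) (lookup⇒[]= j _ Kj))

  below-clique : ∀ {P K} → IsClique G K → P ⊂ K → ∣ P ∣ < C
  below-clique {K = K} K-clique P⊂K = <-≤-trans (p⊂q⇒∣p∣<∣q∣ P⊂K) (cliques K K-clique)

  positive : Fin n → 0 < C
  positive v = subst (_< C) (∣⊥∣≡0 n) (below-clique {⊥} single (⊥⊆ , v , x∈⁅x⁆ v , ∉⊥))
    where
    single : IsClique G ⁅ v ⁆
    single = clique-intro λ i≢j i∈v j∈v →
      ⊥-elim (i≢j (trans (x∈⁅y⁆⇒x≡y v i∈v) (sym (x∈⁅y⁆⇒x≡y v j∈v))))

  edge⇒2≤C : ∀ {u v} → T (adj G u v) → 2 ≤ C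
  edge⇒2≤C {u} {v} uv =
    subst (_< C) (∣⁅x⁆∣≡1 u)
      (below-clique {⁅ u ⁆} edge (p⊆p∪q ⁅ v ⁆ , v , x∈p∪q⁺ (inj₂ (x∈⁅x⁆ v)) , x≢y⇒x∉⁅y⁆ v≢u))
    where
    v≢u : v ≢ u
    v≢u refl = subst T (adj-irr G u) uv
    endpoint : ∀ {x} → x ∈ₛ ⁅ u ⁆ ∪ ⁅ v ⁆ → x ≡ u ⊎ x ≡ v
    endpoint x∈ = Sum.map (x∈⁅y⁆⇒x≡y u) (x∈⁅y⁆⇒x≡y v) (x∈p∪q⁻ ⁅ u ⁆ ⁅ v ⁆ x∈)
    edge : IsClique G (⁅ u ⁆ ∪ ⁅ v ⁆)
    edge = clique-intro λ {i} {j} i≢j i∈ j∈ → adjacent i≢j (endpoint i∈) (endpoint j∈)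
      where
      adjacent : ∀ {i j} → i ≢ j → i ≡ u ⊎ i ≡ v → j ≡ u ⊎ j ≡ v → T (adj G i j)
      adjacent i≢j (inj₁ refl) (inj₁ refl) = ⊥-elim (i≢j refl)
      adjacent i≢j (inj₁ refl) (inj₂ refl) = uv
      adjacent i≢j (inj₂ refl) (inj₁ refl) = subst T (adj-sym G u v) uv
      adjacent i≢j (inj₂ refl) (inj₂ refl) = ⊥-elim (i≢j refl)

module SingletonCuts {n : ℕ} (G : Graph n) {C : ℕ} (cliques : CliquesAtMost G C) where
  open CutsOf G
  open Cliques G cliques

  -- X ⊆ {v} realises N(∅) ∩ Ā or N(v) ∩ Ā; the second is nonempty only
  -- if v has a neighbour, and then C ≥ 2.
  singletonCut-bound : ∀ v → cutCount G ⁅ v ⁆ ≤ C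
  singletonCut-bound v with any? (λ y → T? (adj G v y))
  ... | yes (_ , vy) = ≤-trans (listedCut-bound ⁅ v ⁆ (trace ⁅ v ⁆ ⊥ ∷ trace ⁅ v ⁆ ⁅ v ⁆ ∷ []) listed)
                               (edge⇒2≤C vy)
    where
    listed : ∀ {S} → Realized ⁅ v ⁆ S → S ∈ trace ⁅ v ⁆ ⊥ ∷ trace ⁅ v ⁆ ⁅ v ⁆ ∷ []
    listed (X , X⊆v , refl) with ⊆-singleton X⊆v
    ... | inj₁ refl = here refl
    ... | inj₂ refl = there (here refl)
  ... | no isolated = ≤-trans (listedCut-bound ⁅ v ⁆ (⊥ ∷ []) empty) (positive v)
    where
    empty : ∀ {S} → Realized ⁅ v ⁆ S → S ∈ ⊥ ∷ []
    empty (X , X⊆v , refl) = here (trace-silent λ {x} {y} x∈X _ xy →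
      isolated (y , subst (λ z → T (adj G z y)) (x∈⁅y⁆⇒x≡y v (X⊆v x∈X)) xy))

module IntervalCuts {n : ℕ} (G : Graph n) (l r : Fin n → ℕ) (l≤r : ∀ i → l i ≤ r i)
                    (model : ∀ i j → i ≢ j → (T (adj G i j) ⇔ (l i ≤ r j × l j ≤ r i)))
                    {C : ℕ} (cliques : CliquesAtMost G C) where
  open CutsOf G
  open Cliques G cliques

  DownClosed : Subset n → Set
  DownClosed A = ∀ {x y} → x ∈ₛ A → y ∉ₛ A → r x ≤ r y

  startsBy : Subset n → ℕ → Subset n
  startsBy A t = ∁ A ∩ tabulate (λ y → l y ≤ᵇ t)

  ∈-startsBy⁻ : ∀ {A t y} → y ∈ₛ startsBy A t → y ∉ₛ A × l y ≤ t
  ∈-startsBy⁻ {A} {t} y∈ =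
    let y∈∁A , y∈T = x∈p∩q⁻ (∁ A) _ y∈
    in x∈∁p⇒x∉p y∈∁A , ≤ᵇ⇒≤ _ t (Equivalence.to ∈-tabulate y∈T)

  ∈-startsBy⁺ : ∀ {A t y} → y ∉ₛ A → l y ≤ t → y ∈ₛ startsBy A t
  ∈-startsBy⁺ y∉A ly≤t = x∈p∩q⁺ (x∉p⇒x∈∁p y∉A , Equivalence.from ∈-tabulate (≤⇒≤ᵇ ly≤t))

  startsBy-mono : ∀ {A t t'} → t ≤ t' → startsBy A t ⊆ startsBy A t'
  startsBy-mono t≤t' y∈ = let y∉A , ly≤t = ∈-startsBy⁻ y∈ in ∈-startsBy⁺ y∉A (≤-trans ly≤t t≤t')

  separated : ∀ {A : Subset n} {x y} → x ∈ₛ A → y ∉ₛ A → x ≢ y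
  separated x∈A y∉A refl = y∉A x∈A

  -- In a down-closed cut, X realises the vertices outside A that start no
  -- later than the right end of its rightmost interval x: such a y meets x
  -- (x ends before y does), and no interval of X reaches further right.
  trace-rightmost : ∀ {A X x} → DownClosed A → X ⊆ A → x ∈ₛ X →
                    (∀ {z} → z ∈ₛ X → r z ≤ r x) → trace A X ≡ startsBy A (r x)
  trace-rightmost {A} {X} {x} down X⊆A x∈X rightmost = ⊆-antisym trace⊆ ⊆trace
    where
    trace⊆ : trace A X ⊆ startsBy A (r x)
    trace⊆ y∈ with ∈-trace⁻ y∈
    ... | y∉A , z , z∈X , zy =
      ∈-startsBy⁺ y∉A (≤-trans (proj₂ (Equivalence.to (model _ _ (separated (X⊆A z∈X) y∉A)) zy))
                               (rightmost z∈X))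
    ⊆trace : startsBy A (r x) ⊆ trace A X
    ⊆trace y∈ with ∈-startsBy⁻ y∈
    ... | y∉A , ly≤rx = ∈-trace⁺ y∉A x∈X
      (Equivalence.from (model _ _ (separated (X⊆A x∈X) y∉A))
        (≤-trans (l≤r x) (down (X⊆A x∈X) y∉A) , ly≤rx))

  downClosed-realized : ∀ {A S} → DownClosed A → Realized A S →
                        S ≡ ⊥ ⊎ ∃[ x ] (x ∈ₛ A × S ≡ startsBy A (r x))
  downClosed-realized down (X , X⊆A , refl) with nonempty? X
  ... | no empty = inj₁ (trace-silent λ x∈X _ _ → empty (_ , x∈X))
  ... | yes nonempty =
    let x , x∈X , rightmost = maximiser r nonempty
    in inj₂ (x , X⊆A x∈X , trace-rightmost down X⊆A x∈X rightmost)

  -- Every interval of startsBy A (r x) meets that of x ∈ A, and any two of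
  -- them meet each other, so adding x gives a clique.
  startsBy-clique : ∀ {A x} → DownClosed A → x ∈ₛ A → IsClique G (⁅ x ⁆ ∪ startsBy A (r x))
  startsBy-clique {A} {x} down x∈A = clique-intro λ i≢j i∈ j∈ →
    Equivalence.from (model _ _ i≢j) (meet (member i∈) (member j∈))
    where
    Member : Fin n → Set
    Member i = i ≡ x ⊎ (i ∉ₛ A × l i ≤ r x)
    member : ∀ {i} → i ∈ₛ ⁅ x ⁆ ∪ startsBy A (r x) → Member i
    member i∈ = Sum.map (x∈⁅y⁆⇒x≡y x) ∈-startsBy⁻ (x∈p∪q⁻ ⁅ x ⁆ _ i∈)
    reaches : ∀ {i j} → Member i → Member j → l i ≤ r j
    reaches (inj₁ refl) (inj₁ refl) = l≤r x
    reaches (inj₁ refl) (inj₂ (j∉A , _)) = ≤-trans (l≤r x) (down x∈A j∉A)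
    reaches (inj₂ (_ , li≤rx)) (inj₁ refl) = li≤rx
    reaches (inj₂ (_ , li≤rx)) (inj₂ (j∉A , _)) = ≤-trans li≤rx (down x∈A j∉A)
    meet : ∀ {i j} → Member i → Member j → l i ≤ r j × l j ≤ r i
    meet mi mj = reaches mi mj , reaches mj mi

  -- startsBy A (r x) misses x, so it is a proper subset of that clique
  startsBy-small : ∀ {A x} → DownClosed A → x ∈ₛ A → ∣ startsBy A (r x) ∣ < C
  startsBy-small {x = x} down x∈A =
    below-clique (startsBy-clique down x∈A)
      (q⊆p∪q ⁅ x ⁆ _ , x , x∈p∪q⁺ (inj₁ (x∈⁅x⁆ x)) , λ x∈ → proj₁ (∈-startsBy⁻ x∈) x∈A)

  downClosedCut-bound : ∀ {A} → 0 < C → DownClosed A → cutCount G A ≤ C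
  downClosedCut-bound {A} 0<C down = chainCut-bound A C chain small
    where
    chain : ∀ {S S'} → Realized A S → Realized A S' → S ⊆ S' ⊎ S' ⊆ S
    chain RS RS' with downClosed-realized down RS | downClosed-realized down RS'
    ... | inj₁ refl | _ = inj₁ ⊥⊆
    ... | inj₂ _ | inj₁ refl = inj₂ ⊥⊆
    ... | inj₂ (x , _ , refl) | inj₂ (x' , _ , refl) =
      Sum.map startsBy-mono startsBy-mono (≤-total (r x) (r x'))
    small : ∀ {S} → Realized A S → ∣ S ∣ < C
    small RS with downClosed-realized down RS
    ... | inj₁ refl = subst (_< C) (sym (∣⊥∣≡0 n)) 0<C
    ... | inj₂ (x , x∈A , refl) = startsBy-small down x∈A

-- The caterpillar of the list v ∷ u ∷ … hangs v off the caterpillar of the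
-- rest; its cuts are the single leaves and the sets of the last k vertices.
caterpillar : ∀ {n} → Fin n → List (Fin n) → BTree n
caterpillar v [] = leaf v
caterpillar v (u ∷ us) = node (caterpillar u us) (leaf v)

module _ {n : ℕ} where

  leaves-caterpillar⁻ : ∀ (v : Fin n) us {x} → x ∈ leaves (caterpillar v us) → x ∈ v ∷ us
  leaves-caterpillar⁻ v [] x∈ = x∈
  leaves-caterpillar⁻ v (u ∷ us) x∈ with ∈-++⁻ (leaves (caterpillar u us)) x∈
  ... | inj₁ x∈rest = there (leaves-caterpillar⁻ u us x∈rest)
  ... | inj₂ (here x≡v) = here x≡v

  leaves-caterpillar⁺ : ∀ (v : Fin n) us {x} → x ∈ v ∷ us → x ∈ leaves (caterpillar v us)
  leaves-caterpillar⁺ v [] x∈ = x∈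
  leaves-caterpillar⁺ v (u ∷ us) (here x≡v) = ∈-++⁺ʳ (leaves (caterpillar u us)) (here x≡v)
  leaves-caterpillar⁺ v (u ∷ us) (there x∈) = ∈-++⁺ˡ (leaves-caterpillar⁺ u us x∈)

  caterpillar-unique : ∀ (v : Fin n) us → Unique (v ∷ us) → Unique (leaves (caterpillar v us))
  caterpillar-unique v [] _ = All.[] ∷ []
  caterpillar-unique v (u ∷ us) (v∉rest ∷ unique) =
    Unique.++⁺ (caterpillar-unique u us unique) (All.[] ∷ []) disjoint
    where
    disjoint : ∀ {x} → ¬ (x ∈ leaves (caterpillar u us) × x ∈ v ∷ [])
    disjoint (x∈ , here refl) = All.lookup v∉rest (leaves-caterpillar⁻ u us x∈) refl

  leaves-proper : ∀ (t : BTree n) {s x} → s ∈ properSubtrees t → x ∈ leaves s → x ∈ leaves t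
  leaves-proper (node a b) (here refl) x∈ = ∈-++⁺ˡ x∈
  leaves-proper (node a b) (there (here refl)) x∈ = ∈-++⁺ʳ (leaves a) x∈
  leaves-proper (node a b) (there (there s∈)) x∈ with ∈-++⁻ (properSubtrees a) s∈
  ... | inj₁ s∈a = ∈-++⁺ˡ (leaves-proper a s∈a x∈)
  ... | inj₂ s∈b = ∈-++⁺ʳ (leaves a) (leaves-proper b s∈b x∈)

  caterpillar-cuts : ∀ {ℓ} {R : Fin n → Fin n → Set ℓ} v us → AllPairs R (v ∷ us) →
                     ∀ {s} → s ∈ properSubtrees (caterpillar v us) →
                     (∃[ w ] s ≡ leaf w) ⊎
                     (∀ {x y} → x ∈ leaves s → y ∈ v ∷ us → y ∉ leaves s → R y x)
  caterpillar-cuts {R = R} v (u ∷ us) (v-first ∷ _) (here refl) = inj₂ rest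
    where
    rest : ∀ {x y} → x ∈ leaves (caterpillar u us) → y ∈ v ∷ u ∷ us →
           y ∉ leaves (caterpillar u us) → R y x
    rest x∈ (here refl) _ = All.lookup v-first (leaves-caterpillar⁻ u us x∈)
    rest x∈ (there y∈) y∉ = ⊥-elim (y∉ (leaves-caterpillar⁺ u us y∈))
  caterpillar-cuts v (u ∷ us) _ (there (here refl)) = inj₁ (v , refl)
  caterpillar-cuts {R = R} v (u ∷ us) (v-first ∷ ordered) {s} (there (there s∈))
    with ∈-++⁻ (properSubtrees (caterpillar u us)) s∈
  ... | inj₂ ()
  ... | inj₁ s∈rest = Sum.map₂ extend (caterpillar-cuts u us ordered s∈rest)
    where
    -- v comes before every vertex of the rest, in particular before s
    extend : (∀ {x y} → x ∈ leaves s → y ∈ u ∷ us → y ∉ leaves s → R y x) →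
             ∀ {x y} → x ∈ leaves s → y ∈ v ∷ u ∷ us → y ∉ leaves s → R y x
    extend _ x∈ (here refl) _ =
      All.lookup v-first (leaves-caterpillar⁻ u us (leaves-proper (caterpillar u us) s∈rest x∈))
    extend earlier x∈ (there y∈) y∉ = earlier x∈ y∈ y∉

  ∈-leafSet⁻ : ∀ (s : BTree n) {x} → x ∈ₛ leafSet s → x ∈ leaves s
  ∈-leafSet⁻ (leaf v) x∈ = here (x∈⁅y⁆⇒x≡y v x∈)
  ∈-leafSet⁻ (node a b) x∈ =
    [ ∈-++⁺ˡ ∘ ∈-leafSet⁻ a , ∈-++⁺ʳ (leaves a) ∘ ∈-leafSet⁻ b ]′ (x∈p∪q⁻ (leafSet a) (leafSet b) x∈)

  ∈-leafSet⁺ : ∀ (s : BTree n) {x} → x ∈ leaves s → x ∈ₛ leafSet s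
  ∈-leafSet⁺ (leaf v) (here refl) = x∈⁅x⁆ v
  ∈-leafSet⁺ (node a b) x∈ = x∈p∪q⁺ (Sum.map (∈-leafSet⁺ a) (∈-leafSet⁺ b) (∈-++⁻ (leaves a) x∈))

  -- A duplicate-free list of all vertices, ordered by R, yields a
  -- decomposition tree each of whose cuts is a single vertex or a set A
  -- such that every vertex outside A comes R-before every vertex of A.
  -- (The given vertex only serves to exclude the empty list.)
  linearDecomposition : ∀ {ℓ} {R : Fin n → Fin n → Set ℓ} (vs : List (Fin n)) → Fin n →
                        Unique vs → (∀ x → x ∈ vs) → AllPairs R vs →
                        ∃[ t ] (IsDecompositionTree t ×
                                (∀ {s} → s ∈ properSubtrees t →
                                 (∃[ w ] s ≡ leaf w) ⊎
                                 (∀ {x y} → x ∈ₛ leafSet s → y ∉ₛ leafSet s → R y x)))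
  linearDecomposition [] v _ complete _ with complete v
  ... | ()
  linearDecomposition {R = R} (v ∷ us) _ unique complete ordered =
    caterpillar v us ,
    (caterpillar-unique v us unique , λ x → leaves-caterpillar⁺ v us (complete x)) ,
    cuts
    where
    cuts : ∀ {s} → s ∈ properSubtrees (caterpillar v us) →
           (∃[ w ] s ≡ leaf w) ⊎ (∀ {x y} → x ∈ₛ leafSet s → y ∉ₛ leafSet s → R y x)
    cuts {s} s∈ = Sum.map₂ (λ earlier x∈ y∉ → earlier (∈-leafSet⁻ s x∈) (complete _) (y∉ ∘ ∈-leafSet⁺ s))
                           (caterpillar-cuts v us ordered s∈)

module ByDecreasing {n : ℕ} (f : Fin n → ℕ) where

  order : DecTotalOrder 0ℓ 0ℓ 0ℓ
  order = On.decTotalOrder (Flip.decTotalOrder ≤-decTotalOrder) f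

  open Sort order using (sort; sort-↭; sort-↗)

  vertices : List (Fin n)
  vertices = sort (allFin n)

  vertices-unique : Unique vertices
  vertices-unique = PermutationSetoid.Unique-resp-↭ (setoid (Fin n))
                      (↭⇒↭ₛ (↭-sym (sort-↭ (allFin n)))) (Unique.allFin⁺ n)

  vertices-complete : ∀ x → x ∈ vertices
  vertices-complete x = ∈-resp-↭ (↭-sym (sort-↭ (allFin n))) (∈-allFin x)

  vertices-decreasing : AllPairs (λ x y → f y ≤ f x) vertices
  vertices-decreasing = Sorted⇒AllPairs (DecTotalOrder.totalOrder order) (sort-↗ (allFin n))

mainTheorem4 : ∀ (n : ℕ) (G : Graph (suc n)) → IsIntervalGraph G →
    ∀ (C : ℕ) → IsMaxCliqueSize G C → BoolwAtMostLog G C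
mainTheorem4 n G (l , r , l≤r , model) C (_ , cliques) =
  let t , isTree , cuts = linearDecomposition vertices zero
                            vertices-unique vertices-complete vertices-decreasing
  in t , isTree , λ s s∈ → bound s (cuts s∈)
  where
  open ByDecreasing r
  open Cliques G cliques using (positive)
  open SingletonCuts G cliques using (singletonCut-bound)
  open IntervalCuts G l r l≤r model cliques using (DownClosed; downClosedCut-bound)

  bound : ∀ s → (∃[ w ] s ≡ leaf w) ⊎ DownClosed (leafSet s) → cutCount G (leafSet s) ≤ C
  bound .(leaf w) (inj₁ (w , refl)) = singletonCut-bound w
  bound s (inj₂ down) = downClosedCut-bound (positive zero) down
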